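{- Let $M$ be a finite flat (i.e. finite free) $\mathbb{Z}_\ell$-module and $\gamma$ a $\mathbb{Z}_\ell$-linear endomorphism of $M$. If $(M\otimes_{\mathbb{Z}_\ell}M)_{\Delta\gamma}$ is torsion-free, then $M_\gamma$ is torsion-free.
   Context: For an endomorphism $\gamma$ of $M$, $M_\gamma:=M/\gamma(M)$ denotes the cokernel of $\gamma$, and $\Delta\gamma=\gamma\otimes\gamma$ is the diagonal action on $M\otimes_{\mathbb{Z}_\ell}M$, so $(M\otimes_{\mathbb{Z}_\ell}M)_{\Delta\gamma}$ is the cokernel of $\gamma\otimes\gamma$. -}

module Defs where

open import Data.Nat as ℕ using (ℕ; _^_)
open import Data.Integer as ℤ using (ℤ; +_; _-_)
open import Data.Integer.Divisibility using (_∣_)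
open import Data.Fin using (Fin; zero; suc)
open import Data.Product using (Σ; _×_)
open import Relation.Nullary using (¬_)

-- ℓ-adic integers ℤ_ℓ, modelled as sequences of integers x k read modulo ℓ^k.
-- An element of ℤ_ℓ is a *coherent* sequence (x (k+1) ≡ x k mod ℓ^k);
-- two elements are equal when x k ≡ y k mod ℓ^k for all k.
-- (ℤ_ℓ = lim ℤ/ℓ^k ℤ, presented as a setoid.)

Seq : Set
Seq = ℕ → ℤ

_≡[mod_]_ : ℤ → ℕ → ℤ → Set
a ≡[mod m ] b = (+ m) ∣ (a - b)

Coherent : (ℓ : ℕ) → Seq → Set
Coherent ℓ x = ∀ k → x (ℕ.suc k) ≡[mod ℓ ^ k ] x k

_≈[_]_ : Seq → ℕ → Seq → Set
x ≈[ ℓ ] y = ∀ k → x k ≡[mod ℓ ^ k ] y k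

-- ring operations (pointwise; they preserve coherence and ≈)
_⊕_ : Seq → Seq → Seq
(x ⊕ y) k = x k ℤ.+ y k

_⊛_ : Seq → Seq → Seq
(x ⊛ y) k = x k ℤ.* y k

𝟘 : Seq
𝟘 k = + 0

Σ[_] : (n : ℕ) → (Fin n → Seq) → Seq
Σ[ ℕ.zero ] f = 𝟘
Σ[ ℕ.suc n ] f = f zero ⊕ Σ[ n ] (λ i → f (suc i))

-- The finite free ℤ_ℓ-module M ≅ ℤ_ℓ^n (elements: Fin n → Seq),
-- an endomorphism γ given by its matrix in a basis.
Vect : ℕ → Set
Vect n = Fin n → Seq

Mat : ℕ → Set
Mat n = Fin n → Fin n → Seq

CoherentVec : (ℓ n : ℕ) → Vect n → Set
CoherentVec ℓ n v = ∀ i → Coherent ℓ (v i)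

CoherentMat : (ℓ n : ℕ) → Mat n → Set
CoherentMat ℓ n g = ∀ i j → Coherent ℓ (g i j)

act : (n : ℕ) → Mat n → Vect n → Vect n
act n g v i = Σ[ n ] (λ j → g i j ⊛ v j)

-- M ⊗ M ≅ ℤ_ℓ^(n×n) with basis e_j ⊗ e_l; elements Fin n → Fin n → Seq.
Tens : ℕ → Set
Tens n = Fin n → Fin n → Seq

CoherentTens : (ℓ n : ℕ) → Tens n → Set
CoherentTens ℓ n t = ∀ i j → Coherent ℓ (t i j)

-- diagonal action Δγ = γ ⊗ γ : (γ⊗γ)(e_j ⊗ e_l) = γ e_j ⊗ γ e_l
actΔ : (n : ℕ) → Mat n → Tens n → Tens n
actΔ n g t i k = Σ[ n ] (λ j → Σ[ n ] (λ l → (g i j ⊛ g k l) ⊛ t j l))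

InImage : (ℓ n : ℕ) → Mat n → Vect n → Set
InImage ℓ n g x = Σ (Vect n) λ v → CoherentVec ℓ n v × (∀ i → act n g v i ≈[ ℓ ] x i)

InImageΔ : (ℓ n : ℕ) → Mat n → Tens n → Set
InImageΔ ℓ n g x = Σ (Tens n) λ t → CoherentTens ℓ n t × (∀ i k → actΔ n g t i k ≈[ ℓ ] x i k)

-- M_γ = M / γ(M) is torsion-free: if a ≠ 0 in ℤ_ℓ and a·[x] = 0 in M_γ then [x] = 0.
CokerTorsionFree : (ℓ n : ℕ) → Mat n → Set
CokerTorsionFree ℓ n g =
  (a : Seq) → Coherent ℓ a → ¬ (a ≈[ ℓ ] 𝟘) →
  (x : Vect n) → CoherentVec ℓ n x →
  InImage ℓ n g (λ i → a ⊛ x i) → InImage ℓ n g x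

CokerΔTorsionFree : (ℓ n : ℕ) → Mat n → Set
CokerΔTorsionFree ℓ n g =
  (a : Seq) → Coherent ℓ a → ¬ (a ≈[ ℓ ] 𝟘) →
  (x : Tens n) → CoherentTens ℓ n x →
  InImageΔ ℓ n g (λ i k → a ⊛ x i k) → InImageΔ ℓ n g x

-- If some entry γ r l is an ℓ-adic unit, write a·x = γ v. Then (γ⊗γ)(v ⊗ eₗ) = a·(x ⊗ γeₗ), so by hypothesis
-- x ⊗ γeₗ = (γ⊗γ) t; contracting the second tensor factor against row r of γ gives γ r l · x = γ s, whence
-- x = γ (γ r l⁻¹ · s). Otherwise γ ≡ 0 mod ℓ, and then γ = 0: if γ = ℓ^(e+1) g, then
-- (γ⊗γ)(eⱼ ⊗ eⱼ) = ℓ^(2e+2) (geⱼ ⊗ geⱼ), so geⱼ ⊗ geⱼ lies in the image of γ⊗γ, which is ≡ 0 mod ℓ; its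
-- diagonal entries (g i j)² are thus divisible by ℓ, hence g = ℓ g′ and γ = ℓ^(e+2) g′. Finally, for γ = 0 the
-- relation a·x = 0 puts a·(x ⊗ (1,…,1)) in the (zero) image of γ⊗γ, so x = 0 = γ 0.

{-# OPTIONS --safe #-}
module Submission where

open import Defs
open import Data.Empty using (⊥-elim)
open import Data.Fin.Base using (Fin; zero; suc)
open import Data.Fin.Properties using (all?; ¬∀⟶∃¬)
open import Data.Integer.Base using (ℤ; +_; -[1+_]; _+_; _-_; _*_; -_; ∣_∣)
import Data.Integer.Properties as ℤₚ
open import Data.Integer.Divisibility.Signed
  using (_∣_; divides; _∣?_; ∣-refl; ∣ᵤ⇒∣; ∣⇒∣ᵤ; ∣-trans; ∣m∣n⇒∣m+n; ∣m⇒∣-m; ∣n⇒∣m*n; ∣m⇒∣m*n; *-cancelˡ-∣)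
open import Data.Integer.Tactic.RingSolver using (solve-∀)
open import Data.Nat.Base as ℕ using (ℕ; zero; suc; _^_; NonZero; NonTrivial)
import Data.Nat.Properties as ℕₚ
import Data.Nat.Divisibility as ℕᵈ
open import Data.Nat.Coprimality using (Coprime; coprime-Bézout; coprime-divisor; 1-coprimeTo)
open import Data.Nat.GCD using (module Bézout)
open import Data.Nat.Primality using (Prime; euclidsLemma; prime⇒irreducible; prime⇒nonZero; prime⇒nonTrivial)
open import Data.Product.Base using (∃; ∃₂; _×_; _,_; proj₁; proj₂)
open import Data.Sum.Base using (_⊎_; inj₁; inj₂; [_,_]′)
open import Function.Base using (_∘_; const)
open import Level using (0ℓ)
open import Relation.Binary.Bundles using (Setoid)
open import Relation.Binary.Structures using (IsEquivalence)
open import Relation.Binary.PropositionalEquality using (_≡_; refl; sym; trans; cong; cong₂; subst; subst₂; module ≡-Reasoning)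
import Relation.Binary.Reasoning.Setoid as SetoidReasoning
open import Algebra.Properties.CommutativeSemigroup ℤₚ.*-commutativeSemigroup
  using (interchange; x∙yz≈y∙xz; x∙yz≈y∙zx; x∙yz≈yx∙z; xy∙z≈y∙xz)
open import Relation.Nullary using (¬_; Dec; yes; no)

open _∣_ using (quotient; equality)

variable
  a a′ b b′ c : ℤ
  x : Seq
  ℓ m m′ n : ℕ

-- Congruences of integers

-- Unlike _≡[mod_]_, this record determines a and b, so they can be inferred by unification.
infix 4 _≡_[mod_]

record _≡_[mod_] (a b : ℤ) (m : ℕ) : Set where
  constructor congruent
  field +m∣a-b : + m ∣ a - b
open _≡_[mod_]

fromUnsigned : a ≡[mod m ] b → a ≡ b [mod m ]
fromUnsigned m∣a-b = congruent (∣ᵤ⇒∣ m∣a-b)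

toUnsigned : a ≡ b [mod m ] → a ≡[mod m ] b
toUnsigned (congruent m∣a-b) = ∣⇒∣ᵤ m∣a-b

≡⇒≡-mod : a ≡ b → a ≡ b [mod m ]
≡⇒≡-mod {a} {m = m} refl = congruent (subst (+ m ∣_) (sym (ℤₚ.+-inverseʳ a)) (∣ᵤ⇒∣ (m ℕᵈ.∣0)))

≡-mod-sym : a ≡ b [mod m ] → b ≡ a [mod m ]
≡-mod-sym {a} {b} (congruent m∣a-b) = congruent (subst (_ ∣_) (negate-difference a b) (∣m⇒∣-m m∣a-b))
  where
  negate-difference : ∀ a b → - (a - b) ≡ b - a
  negate-difference = solve-∀

≡-mod-trans : a ≡ b [mod m ] → b ≡ c [mod m ] → a ≡ c [mod m ]
≡-mod-trans {a} {b} {c = c} (congruent m∣a-b) (congruent m∣b-c) =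
  congruent (subst (_ ∣_) (ℤₚ.+-minus-telescope a b c) (∣m∣n⇒∣m+n m∣a-b m∣b-c))

≡-mod-isEquivalence : IsEquivalence (λ a b → a ≡ b [mod m ])
≡-mod-isEquivalence = record { refl = ≡⇒≡-mod refl ; sym = ≡-mod-sym ; trans = ≡-mod-trans }

≡-mod-setoid : ℕ → Setoid 0ℓ 0ℓ
≡-mod-setoid m = record { isEquivalence = ≡-mod-isEquivalence {m} }

module ≡-mod-Reasoning (m : ℕ) = SetoidReasoning (≡-mod-setoid m)

+-cong : a ≡ a′ [mod m ] → b ≡ b′ [mod m ] → a + b ≡ a′ + b′ [mod m ]
+-cong {a} {a′} {b = b} {b′} (congruent p) (congruent q) =
  congruent (subst (_ ∣_) (regroup a a′ b b′) (∣m∣n⇒∣m+n p q))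
  where
  regroup : ∀ a a′ b b′ → (a - a′) + (b - b′) ≡ (a + b) - (a′ + b′)
  regroup = solve-∀

*-cong : a ≡ a′ [mod m ] → b ≡ b′ [mod m ] → a * b ≡ a′ * b′ [mod m ]
*-cong {a} {a′} {b = b} {b′} (congruent p) (congruent q) =
  congruent (subst (_ ∣_) (regroup a a′ b b′) (∣m∣n⇒∣m+n (∣n⇒∣m*n a q) (∣m⇒∣m*n b′ p)))
  where
  regroup : ∀ a a′ b b′ → a * (b - b′) + (a - a′) * b′ ≡ a * b - a′ * b′
  regroup = solve-∀

*-congˡ : ∀ a → b ≡ b′ [mod m ] → a * b ≡ a * b′ [mod m ]
*-congˡ a = *-cong (≡⇒≡-mod {a = a} refl)

*-congʳ : ∀ b → a ≡ a′ [mod m ] → a * b ≡ a′ * b [mod m ]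
*-congʳ b a≡a′ = *-cong a≡a′ (≡⇒≡-mod {a = b} refl)

≡-mod-weaken : m ℕᵈ.∣ m′ → a ≡ b [mod m′ ] → a ≡ b [mod m ]
≡-mod-weaken m∣m′ (congruent m′∣a-b) = congruent (∣-trans (∣ᵤ⇒∣ m∣m′) m′∣a-b)

∣-respʳ-≡-mod : a ≡ b [mod m ] → + m ∣ b → + m ∣ a
∣-respʳ-≡-mod {a} {b} (congruent m∣a-b) m∣b = subst (_ ∣_) (restore a b) (∣m∣n⇒∣m+n m∣a-b m∣b)
  where
  restore : ∀ a b → (a - b) + b ≡ a
  restore = solve-∀

∣⇒≡-mod-0 : + m ∣ a → a ≡ + 0 [mod m ]
∣⇒≡-mod-0 {a = a} m∣a = congruent (subst (_ ∣_) (sym (ℤₚ.+-identityʳ a)) m∣a)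

≡-mod-intro : ∀ c → b + c * + m ≡ a → a ≡ b [mod m ]
≡-mod-intro {b} {m} c refl = congruent (divides c (cancel b (c * + m)))
  where
  cancel : ∀ b d → (b + d) - b ≡ d
  cancel = solve-∀

prime∣square⇒∣ : Prime ℓ → + ℓ ∣ a * a → + ℓ ∣ a
prime∣square⇒∣ {a = a} ℓ-prime ℓ∣a² =
  [ ∣ᵤ⇒∣ , ∣ᵤ⇒∣ ]′ (euclidsLemma ∣ a ∣ ∣ a ∣ ℓ-prime (subst (_ ℕᵈ.∣_) (ℤₚ.abs-* a a) (∣⇒∣ᵤ ℓ∣a²)))

prime∤⇒coprime : ∀ {k} → Prime ℓ → ¬ ℓ ℕᵈ.∣ k → Coprime ℓ k
prime∤⇒coprime ℓ-prime ℓ∤k (i∣ℓ , i∣k) with prime⇒irreducible ℓ-prime i∣ℓ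
... | inj₁ i≡1 = i≡1
... | inj₂ refl = ⊥-elim (ℓ∤k i∣k)

coprime-^ : ∀ {k} → Coprime ℓ k → ∀ e → Coprime (ℓ ^ e) k
coprime-^ _ zero = 1-coprimeTo _
coprime-^ {ℓ} {k} ℓ⊥k (suc e) {i} (i∣ℓℓ^e , i∣k) = coprime-^ ℓ⊥k e (coprime-divisor i⊥ℓ i∣ℓℓ^e , i∣k)
  where
  i⊥ℓ : Coprime i ℓ
  i⊥ℓ (j∣i , j∣ℓ) = ℓ⊥k (j∣ℓ , ℕᵈ.∣-trans j∣i i∣k)

coprime⇒inverse⁺ : ∀ {k} → Coprime m k → ∃ λ w → + k * w ≡ + 1 [mod m ]
coprime⇒inverse⁺ {m} {k} m⊥k with coprime-Bézout m⊥k
... | Bézout.+- u v 1+vk≡um = - (+ v) , ≡-mod-sym (≡-mod-intro (+ u) (begin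
  + k * - (+ v) + + u * + m            ≡⟨ cong (λ z → + k * - (+ v) + z) (ℤₚ.pos-* u m) ⟨
  + k * - (+ v) + + (u ℕ.* m)          ≡⟨ cong (λ z → + k * - (+ v) + + z) 1+vk≡um ⟨
  + k * - (+ v) + (+ 1 + + (v ℕ.* k))  ≡⟨ cong (λ z → + k * - (+ v) + (+ 1 + z)) (ℤₚ.pos-* v k) ⟩
  + k * - (+ v) + (+ 1 + + v * + k)    ≡⟨ cancel (+ k) (+ v) ⟩
  + 1                                  ∎))
  where
  open ≡-Reasoning
  cancel : ∀ k v → k * - v + (+ 1 + v * k) ≡ + 1
  cancel = solve-∀
... | Bézout.-+ u v 1+um≡vk = + v , ≡-mod-intro (+ u) (begin
  + 1 + + u * + m      ≡⟨ cong (λ z → + 1 + z) (ℤₚ.pos-* u m) ⟨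
  + (1 ℕ.+ u ℕ.* m)    ≡⟨ cong +_ 1+um≡vk ⟩
  + (v ℕ.* k)          ≡⟨ ℤₚ.pos-* v k ⟩
  + v * + k            ≡⟨ ℤₚ.*-comm (+ v) (+ k) ⟩
  + k * + v            ∎)
  where open ≡-Reasoning

coprime⇒inverse : ∀ a → Coprime m ∣ a ∣ → ∃ λ w → a * w ≡ + 1 [mod m ]
coprime⇒inverse (+ k) m⊥k = coprime⇒inverse⁺ m⊥k
coprime⇒inverse -[1+ k ] m⊥k with coprime⇒inverse⁺ m⊥k
... | w , [1+k]w≡1 = - w , ≡-mod-trans (≡⇒≡-mod (neg*neg (+ suc k) w)) [1+k]w≡1
  where
  neg*neg : ∀ a w → - a * - w ≡ a * w
  neg*neg = solve-∀

inverse-unique : a ≡ a′ [mod m ] → a * b ≡ + 1 [mod m ] → a′ * b′ ≡ + 1 [mod m ] → b ≡ b′ [mod m ]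
inverse-unique {a} {a′} {m} {b} {b′} a≡a′ ab≡1 a′b′≡1 = begin
  b              ≡⟨ ℤₚ.*-identityʳ b ⟨
  b * + 1        ≈⟨ *-congˡ b a′b′≡1 ⟨
  b * (a′ * b′)  ≈⟨ *-congˡ b (*-congʳ b′ a≡a′) ⟨
  b * (a * b′)   ≡⟨ x∙yz≈yx∙z b a b′ ⟩
  (a * b) * b′   ≈⟨ *-congʳ b′ ab≡1 ⟩
  + 1 * b′       ≡⟨ ℤₚ.*-identityˡ b′ ⟩
  b′             ∎
  where open ≡-mod-Reasoning m

-- ℓ-adic integers as coherent sequences

coherent-step : Coherent ℓ x → ∀ k → x (suc k) ≡ x k [mod ℓ ^ k ]
coherent-step x-coh k = fromUnsigned (x-coh k)

coherent⇒≡-mod-ℓ : ∀ x → Coherent ℓ x → ∀ k → x (suc k) ≡ x 1 [mod ℓ ]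
coherent⇒≡-mod-ℓ _ _ zero = ≡⇒≡-mod refl
coherent⇒≡-mod-ℓ {ℓ} x x-coh (suc k) =
  ≡-mod-trans (≡-mod-weaken (ℕᵈ.m∣m*n (ℓ ^ k)) (coherent-step {x = x} x-coh (suc k))) (coherent⇒≡-mod-ℓ x x-coh k)

const-coherent : ∀ a → Coherent ℓ (const a)
const-coherent a k = toUnsigned (≡⇒≡-mod {a = a} refl)

⊕-coherent : ∀ x y → Coherent ℓ x → Coherent ℓ y → Coherent ℓ (x ⊕ y)
⊕-coherent x y x-coh y-coh k = toUnsigned (+-cong (coherent-step {x = x} x-coh k) (coherent-step {x = y} y-coh k))

⊛-coherent : ∀ x y → Coherent ℓ x → Coherent ℓ y → Coherent ℓ (x ⊛ y)
⊛-coherent x y x-coh y-coh k = toUnsigned (*-cong (coherent-step {x = x} x-coh k) (coherent-step {x = y} y-coh k))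

Σ-coherent : ∀ n (f : Fin n → Seq) → (∀ p → Coherent ℓ (f p)) → Coherent ℓ (Σ[ n ] f)
Σ-coherent zero _ _ = const-coherent (+ 0)
Σ-coherent (suc n) f f-coh =
  ⊕-coherent (f zero) (Σ[ n ] (f ∘ suc)) (f-coh zero) (Σ-coherent n (f ∘ suc) (f-coh ∘ suc))

divide-by-ℓ : .{{NonZero ℓ}} → ∀ x → Coherent ℓ x → + ℓ ∣ x 1 →
  ∃ λ x′ → Coherent ℓ x′ × (∀ k → + ℓ * x′ k ≡ x k [mod ℓ ^ k ])
divide-by-ℓ {ℓ} x x-coh ℓ∣x₁ = x′ , x′-coh , ℓx′≡x
  where
  ℓ∣x : ∀ k → + ℓ ∣ x (suc k)
  ℓ∣x k = ∣-respʳ-≡-mod (coherent⇒≡-mod-ℓ x x-coh k) ℓ∣x₁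

  x′ : Seq
  x′ k = quotient (ℓ∣x k)

  x≡ℓx′ : ∀ k → x (suc k) ≡ + ℓ * x′ k
  x≡ℓx′ k = trans (equality (ℓ∣x k)) (ℤₚ.*-comm (x′ k) (+ ℓ))

  ℓx′≡x : ∀ k → + ℓ * x′ k ≡ x k [mod ℓ ^ k ]
  ℓx′≡x k = ≡-mod-trans (≡⇒≡-mod (sym (x≡ℓx′ k))) (coherent-step {x = x} x-coh k)

  factor : ∀ l a b → l * a - l * b ≡ l * (a - b)
  factor = solve-∀

  x′-coh : Coherent ℓ x′
  x′-coh k = ∣⇒∣ᵤ (*-cancelˡ-∣ (+ ℓ) (subst₂ _∣_ (ℤₚ.pos-* ℓ (ℓ ^ k))
    (trans (cong₂ _-_ (x≡ℓx′ (suc k)) (x≡ℓx′ k)) (factor (+ ℓ) (x′ (suc k)) (x′ k)))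
    (+m∣a-b (coherent-step {x = x} x-coh (suc k)))))

record Invertible (ℓ : ℕ) (x : Seq) : Set where
  field
    inverse          : Seq
    inverse-coherent : Coherent ℓ inverse
    *-inverse        : ∀ k → x k * inverse k ≡ + 1 [mod ℓ ^ k ]

unit⇒invertible : Prime ℓ → ∀ x → Coherent ℓ x → ¬ (+ ℓ ∣ x 1) → Invertible ℓ x
unit⇒invertible {ℓ} ℓ-prime x x-coh ℓ∤x₁ = record
  { inverse = x⁻¹ ; inverse-coherent = x⁻¹-coh ; *-inverse = xx⁻¹≡1 }
  where
  ℓ∤x : ∀ k → ¬ ℓ ℕᵈ.∣ ∣ x (suc k) ∣
  ℓ∤x k = ℓ∤x₁ ∘ ∣-respʳ-≡-mod (≡-mod-sym (coherent⇒≡-mod-ℓ x x-coh k)) ∘ ∣ᵤ⇒∣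

  ℓ^k⊥x : ∀ k → Coprime (ℓ ^ k) ∣ x k ∣
  ℓ^k⊥x zero    = 1-coprimeTo _
  ℓ^k⊥x (suc k) = coprime-^ (prime∤⇒coprime ℓ-prime (ℓ∤x k)) (suc k)

  x⁻¹ : Seq
  x⁻¹ k = proj₁ (coprime⇒inverse (x k) (ℓ^k⊥x k))

  xx⁻¹≡1 : ∀ k → x k * x⁻¹ k ≡ + 1 [mod ℓ ^ k ]
  xx⁻¹≡1 k = proj₂ (coprime⇒inverse (x k) (ℓ^k⊥x k))

  x⁻¹-coh : Coherent ℓ x⁻¹
  x⁻¹-coh k = toUnsigned (inverse-unique (coherent-step {x = x} x-coh k)
    (≡-mod-weaken (ℕᵈ.n∣m*n ℓ) (xx⁻¹≡1 (suc k))) (xx⁻¹≡1 k))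

ℓ^e≉𝟘 : .{{NonTrivial ℓ}} → ∀ e → ¬ (const (+ (ℓ ^ e)) ≈[ ℓ ] 𝟘)
ℓ^e≉𝟘 {ℓ} e ℓ^e≈0 = ℕ.nonTrivial⇒≢1 (ℕᵈ.∣1⇒≡1 (ℕᵈ.*-cancelʳ-∣ (ℓ ^ e) {{ℕₚ.m^n≢0 ℓ e}} ℓℓ^e∣ℓ^e))
  where
  instance
    _ : NonZero ℓ
    _ = ℕ.nonTrivial⇒nonZero ℓ
  -- level e + 1 of ℓ^e≈0 reads ℓ ^ suc e ∣ ℓ ^ e ℕ.+ 0, and ℓ ^ e ℕ.+ 0 is 1 ℕ.* ℓ ^ e by definition
  ℓℓ^e∣ℓ^e : ℓ ℕ.* ℓ ^ e ℕᵈ.∣ 1 ℕ.* ℓ ^ e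
  ℓℓ^e∣ℓ^e = ℓ^e≈0 (suc e)

-- Finite sums and the modules ℤ_ℓⁿ and ℤ_ℓⁿ ⊗ ℤ_ℓⁿ

Σ-cong : ∀ n {f g : Fin n → Seq} {k} → (∀ p → f p k ≡ g p k) → Σ[ n ] f k ≡ Σ[ n ] g k
Σ-cong zero    _   = refl
Σ-cong (suc n) f≡g = cong₂ _+_ (f≡g zero) (Σ-cong n (f≡g ∘ suc))

Σ-∣ : ∀ n {f : Fin n → Seq} {k} → (∀ p → + m ∣ f p k) → + m ∣ Σ[ n ] f k
Σ-∣ {m} zero    _   = ∣ᵤ⇒∣ (m ℕᵈ.∣0)
Σ-∣ (suc n) m∣f = ∣m∣n⇒∣m+n (m∣f zero) (Σ-∣ n (m∣f ∘ suc))

Σ-factorˡ : ∀ n a (g : Fin n → Seq) {f k} → (∀ p → f p k ≡ a * g p k) → Σ[ n ] f k ≡ a * Σ[ n ] g k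
Σ-factorˡ zero    a _ _ = sym (ℤₚ.*-zeroʳ a)
Σ-factorˡ (suc n) a g {k = k} f≡ag =
  trans (cong₂ _+_ (f≡ag zero) (Σ-factorˡ n a (g ∘ suc) (f≡ag ∘ suc))) (sym (ℤₚ.*-distribˡ-+ a (g zero k) _))

Σ-zero : ∀ n {f : Fin n → Seq} {k} → (∀ p → f p k ≡ + 0) → Σ[ n ] f k ≡ + 0
Σ-zero zero    _    = refl
Σ-zero (suc n) f≡0 = cong₂ _+_ (f≡0 zero) (Σ-zero n (f≡0 ∘ suc))

δ : Fin n → Fin n → ℤ
δ zero    zero    = + 1
δ zero    (suc _) = + 0
δ (suc _) zero    = + 0
δ (suc i) (suc j) = δ i j

basis : Fin n → Vect n
basis j p = const (δ j p)

Σ-basis : ∀ n (f : Fin n → Seq) j {k} → Σ[ n ] (λ p → f p ⊛ basis j p) k ≡ f j k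
Σ-basis (suc n) f zero {k} =
  trans (cong₂ _+_ (ℤₚ.*-identityʳ (f zero k)) (Σ-zero n (λ p → ℤₚ.*-zeroʳ (f (suc p) k))))
        (ℤₚ.+-identityʳ (f zero k))
Σ-basis (suc n) f (suc j) {k} =
  trans (cong₂ _+_ (ℤₚ.*-zeroʳ (f zero k)) (Σ-basis n (f ∘ suc) j)) (ℤₚ.+-identityˡ (f (suc j) k))

_⊗_ : Vect n → Vect n → Tens n
(y ⊗ z) p q = y p ⊛ z q

column : Mat n → Fin n → Vect n
column g j i = g i j

contract : Vect n → Tens n → Vect n
contract {n} w t p = Σ[ n ] (λ q → w q ⊛ t p q)

basis-coherent : ∀ j → CoherentVec ℓ n (basis j)
basis-coherent j p = const-coherent (δ j p)

⊗-coherent : (y z : Vect n) → CoherentVec ℓ n y → CoherentVec ℓ n z → CoherentTens ℓ n (y ⊗ z)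
⊗-coherent y z y-coh z-coh p q = ⊛-coherent (y p) (z q) (y-coh p) (z-coh q)

act-basis : ∀ n (g : Mat n) j i {k} → act n g (basis j) i k ≡ g i j k
act-basis n g j i = Σ-basis n (g i) j

act-scale : ∀ n (g : Mat n) c v i {k} → act n g (λ p → c ⊛ v p) i k ≡ c k * act n g v i k
act-scale n g c v i {k} = Σ-factorˡ n (c k) (λ p → g i p ⊛ v p) (λ p → x∙yz≈y∙xz (g i p k) (c k) (v p k))

actΔ-⊗ : ∀ n (g : Mat n) y z i j {k} → actΔ n g (y ⊗ z) i j k ≡ act n g y i k * act n g z j k
actΔ-⊗ n g y z i j {k} = begin
  actΔ n g (y ⊗ z) i j k
    ≡⟨ Σ-cong n (λ p → Σ-factorˡ n (g i p k * y p k) (λ q → g j q ⊛ z q)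
         (λ q → interchange (g i p k) (g j q k) (y p k) (z q k))) ⟩
  Σ[ n ] (λ p → (g i p ⊛ y p) ⊛ act n g z j) k
    ≡⟨ Σ-factorˡ n (act n g z j k) (λ p → g i p ⊛ y p) (λ p → ℤₚ.*-comm (g i p k * y p k) _) ⟩
  act n g z j k * act n g y i k
    ≡⟨ ℤₚ.*-comm (act n g z j k) _ ⟩
  act n g y i k * act n g z j k ∎
  where open ≡-Reasoning

actΔ-contract : ∀ n (g : Mat n) t i j {k} → actΔ n g t i j k ≡ act n g (contract (g j) t) i k
actΔ-contract n g t i j {k} =
  Σ-cong n (λ p → Σ-factorˡ n (g i p k) (λ q → g j q ⊛ t p q) (λ q → ℤₚ.*-assoc (g i p k) (g j q k) (t p q k)))

act-∣ : ∀ n (g : Mat n) v i {k} → (∀ p q → + m ∣ g p q k) → + m ∣ act n g v i k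
act-∣ n g v i m∣g = Σ-∣ n (λ p → ∣m⇒∣m*n _ (m∣g i p))

actΔ-∣ : ∀ n (g : Mat n) t i j {k} → (∀ p q → + m ∣ g p q k) → + m ∣ actΔ n g t i j k
actΔ-∣ n g t i j m∣g = Σ-∣ n (λ p → Σ-∣ n (λ q → ∣m⇒∣m*n _ (∣m⇒∣m*n _ (m∣g i p))))

-- Some entry of γ is a unit

actΔ-image⊗basis : (γ : Mat n) (a : Seq) (v x : Vect n) → (∀ i → act n γ v i ≈[ ℓ ] (a ⊛ x i)) →
  ∀ l i j → actΔ n γ (v ⊗ basis l) i j ≈[ ℓ ] (a ⊛ (x ⊗ column γ l) i j)
actΔ-image⊗basis {n} {ℓ} γ a v x γv≈ax l i j K = toUnsigned (begin
  actΔ n γ (v ⊗ basis l) i j K            ≡⟨ actΔ-⊗ n γ v (basis l) i j ⟩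
  act n γ v i K * act n γ (basis l) j K   ≡⟨ cong (act n γ v i K *_) (act-basis n γ l j) ⟩
  act n γ v i K * γ j l K                 ≈⟨ *-congʳ (γ j l K) γv≡ax ⟩
  a K * x i K * γ j l K                   ≡⟨ ℤₚ.*-assoc (a K) (x i K) (γ j l K) ⟩
  a K * (x i K * γ j l K)                 ∎)
  where
  open ≡-mod-Reasoning (ℓ ^ K)
  γv≡ax : act n γ v i K ≡ a K * x i K [mod ℓ ^ K ]
  γv≡ax = fromUnsigned (γv≈ax i K)

inImage-of-⊗-column : (γ : Mat n) → CoherentMat ℓ n γ → ∀ r l → Invertible ℓ (γ r l) →
  ∀ x → InImageΔ ℓ n γ (x ⊗ column γ l) → InImage ℓ n γ x
inImage-of-⊗-column {n} {ℓ} γ γ-coh r l γrl-invertible x (t , t-coh , γΔt≈x⊗γₗ) = u , u-coh , γu≈x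
  where
  open Invertible γrl-invertible renaming (inverse to γrl⁻¹; inverse-coherent to γrl⁻¹-coh)

  u : Vect n
  u p = γrl⁻¹ ⊛ contract (γ r) t p

  u-coh : CoherentVec ℓ n u
  u-coh p = ⊛-coherent γrl⁻¹ (contract (γ r) t p) γrl⁻¹-coh
    (Σ-coherent n (λ q → γ r q ⊛ t p q) (λ q → ⊛-coherent (γ r q) (t p q) (γ-coh r q) (t-coh p q)))

  γu≈x : ∀ i → act n γ u i ≈[ ℓ ] x i
  γu≈x i K = toUnsigned (begin
    act n γ u i K                          ≡⟨ act-scale n γ γrl⁻¹ (contract (γ r) t) i ⟩
    γrl⁻¹ K * act n γ (contract (γ r) t) i K ≡⟨ cong (γrl⁻¹ K *_) (actΔ-contract n γ t i r) ⟨
    γrl⁻¹ K * actΔ n γ t i r K             ≈⟨ *-congˡ (γrl⁻¹ K) γΔt≡x⊗γₗ ⟩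
    γrl⁻¹ K * (x i K * γ r l K)            ≡⟨ x∙yz≈y∙zx (γrl⁻¹ K) (x i K) (γ r l K) ⟩
    x i K * (γ r l K * γrl⁻¹ K)            ≈⟨ *-congˡ (x i K) (*-inverse K) ⟩
    x i K * + 1                            ≡⟨ ℤₚ.*-identityʳ (x i K) ⟩
    x i K                                  ∎)
    where
    open ≡-mod-Reasoning (ℓ ^ K)
    γΔt≡x⊗γₗ : actΔ n γ t i r K ≡ x i K * γ r l K [mod ℓ ^ K ]
    γΔt≡x⊗γₗ = fromUnsigned (γΔt≈x⊗γₗ i r K)

unit-entry⇒torsionFree : Prime ℓ → (γ : Mat n) → CoherentMat ℓ n γ → CokerΔTorsionFree ℓ n γ →
  ∀ r l → ¬ (+ ℓ ∣ γ r l 1) → CokerTorsionFree ℓ n γ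
unit-entry⇒torsionFree ℓ-prime γ γ-coh Δ-torsionFree r l ℓ∤γrl a a-coh a≉0 x x-coh (v , v-coh , γv≈ax) =
  inImage-of-⊗-column γ γ-coh r l (unit⇒invertible ℓ-prime (γ r l) (γ-coh r l) ℓ∤γrl) x
    (Δ-torsionFree a a-coh a≉0 (x ⊗ column γ l) (⊗-coherent x (column γ l) x-coh (λ k → γ-coh k l))
      (v ⊗ basis l , ⊗-coherent v (basis l) v-coh (basis-coherent l) , actΔ-image⊗basis γ a v x γv≈ax l))

-- Every entry of γ is divisible by ℓ

actΔ-basis⊗basis : ∀ c (γ g : Mat n) → (∀ i j K → + c * g i j K ≡ γ i j K [mod ℓ ^ K ]) →
  ∀ j l p q → actΔ n γ (basis j ⊗ basis l) p q ≈[ ℓ ] (const (+ c * + c) ⊛ (column g j ⊗ column g l) p q)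
actΔ-basis⊗basis {n} {ℓ} c γ g γ≡cg j l p q K = toUnsigned (begin
  actΔ n γ (basis j ⊗ basis l) p q K               ≡⟨ actΔ-⊗ n γ (basis j) (basis l) p q ⟩
  act n γ (basis j) p K * act n γ (basis l) q K   ≡⟨ cong₂ _*_ (act-basis n γ j p) (act-basis n γ l q) ⟩
  γ p j K * γ q l K                               ≈⟨ *-cong (γ≡cg p j K) (γ≡cg q l K) ⟨
  (+ c * g p j K) * (+ c * g q l K)               ≡⟨ interchange (+ c) (g p j K) (+ c) (g q l K) ⟩
  (+ c * + c) * (g p j K * g q l K)               ∎)
  where open ≡-mod-Reasoning (ℓ ^ K)

cofactor-divisible : Prime ℓ → (γ g : Mat n) → CoherentMat ℓ n g → CokerΔTorsionFree ℓ n γ →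
  ∀ e → (∀ i j K → + (ℓ ^ suc e) * g i j K ≡ γ i j K [mod ℓ ^ K ]) → ∀ i j → + ℓ ∣ g i j 1
cofactor-divisible {ℓ} {n} ℓ-prime γ g g-coh Δ-torsionFree e γ≡ℓ¹⁺ᵉg i j =
  prime∣square⇒∣ ℓ-prime (∣-respʳ-≡-mod gᵢⱼ²≡γΔt (actΔ-∣ n γ t i i ℓ∣γ))
  where
  instance
    _ : NonTrivial ℓ
    _ = prime⇒nonTrivial ℓ-prime

  ℓ¹⁺ᵉ : ℕ
  ℓ¹⁺ᵉ = ℓ ^ suc e

  ℓ²⁺²ᵉ≉0 : ¬ (const (+ ℓ¹⁺ᵉ * + ℓ¹⁺ᵉ) ≈[ ℓ ] 𝟘)
  ℓ²⁺²ᵉ≉0 = subst (λ c² → ¬ (const c² ≈[ ℓ ] 𝟘))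
    (trans (cong +_ (ℕₚ.^-distribˡ-+-* ℓ (suc e) (suc e))) (ℤₚ.pos-* ℓ¹⁺ᵉ ℓ¹⁺ᵉ)) (ℓ^e≉𝟘 (suc e ℕ.+ suc e))

  gⱼ : Vect n
  gⱼ = column g j

  preimage : InImageΔ ℓ n γ (gⱼ ⊗ gⱼ)
  preimage = Δ-torsionFree (const (+ ℓ¹⁺ᵉ * + ℓ¹⁺ᵉ)) (const-coherent (+ ℓ¹⁺ᵉ * + ℓ¹⁺ᵉ)) ℓ²⁺²ᵉ≉0
    (gⱼ ⊗ gⱼ) (⊗-coherent gⱼ gⱼ (λ k → g-coh k j) (λ k → g-coh k j))
    (basis j ⊗ basis j , ⊗-coherent (basis j) (basis j) (basis-coherent j) (basis-coherent j) ,
     actΔ-basis⊗basis ℓ¹⁺ᵉ γ g γ≡ℓ¹⁺ᵉg j j)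

  t : Tens n
  t = proj₁ preimage

  gᵢⱼ²≡γΔt : g i j 1 * g i j 1 ≡ actΔ n γ t i i 1 [mod ℓ ]
  gᵢⱼ²≡γΔt = ≡-mod-sym (≡-mod-weaken (ℕᵈ.m∣m*n 1) (fromUnsigned (proj₂ (proj₂ preimage) i i 1)))

  ℓ∣γ : ∀ p q → + ℓ ∣ γ p q 1
  ℓ∣γ p q = ∣-respʳ-≡-mod (≡-mod-sym (≡-mod-weaken (ℕᵈ.m∣m*n 1) (γ≡ℓ¹⁺ᵉg p q 1)))
    (∣m⇒∣m*n (g p q 1) (∣ᵤ⇒∣ {+ ℓ} {+ ℓ¹⁺ᵉ} (ℕᵈ.m∣m*n (ℓ ^ e))))

PowerFactor : (ℓ n : ℕ) → Mat n → ℕ → Set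
PowerFactor ℓ n γ e = ∃ λ (g : Mat n) →
  CoherentMat ℓ n g × (∀ i j K → + (ℓ ^ e) * g i j K ≡ γ i j K [mod ℓ ^ K ]) × (∀ i j → + ℓ ∣ g i j 1)

powerFactor-zero : (γ : Mat n) → CoherentMat ℓ n γ → (∀ i j → + ℓ ∣ γ i j 1) → PowerFactor ℓ n γ 0
powerFactor-zero γ γ-coh ℓ∣γ = γ , γ-coh , (λ i j K → ≡⇒≡-mod (ℤₚ.*-identityˡ (γ i j K))) , ℓ∣γ

powerFactor-suc : Prime ℓ → (γ : Mat n) → CokerΔTorsionFree ℓ n γ →
  ∀ e → PowerFactor ℓ n γ e → PowerFactor ℓ n γ (suc e)
powerFactor-suc {ℓ} {n} ℓ-prime γ Δ-torsionFree e (g , g-coh , γ≡ℓᵉg , ℓ∣g) =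
  g′ , g′-coh , γ≡ℓ¹⁺ᵉg′ , cofactor-divisible ℓ-prime γ g′ g′-coh Δ-torsionFree e γ≡ℓ¹⁺ᵉg′
  where
  instance
    _ : NonZero ℓ
    _ = prime⇒nonZero ℓ-prime

  quotients : ∀ i j → ∃ λ x′ → Coherent ℓ x′ × (∀ K → + ℓ * x′ K ≡ g i j K [mod ℓ ^ K ])
  quotients i j = divide-by-ℓ (g i j) (g-coh i j) (ℓ∣g i j)

  g′ : Mat n
  g′ i j = proj₁ (quotients i j)

  g′-coh : CoherentMat ℓ n g′
  g′-coh i j = proj₁ (proj₂ (quotients i j))

  γ≡ℓ¹⁺ᵉg′ : ∀ i j K → + (ℓ ^ suc e) * g′ i j K ≡ γ i j K [mod ℓ ^ K ]
  γ≡ℓ¹⁺ᵉg′ i j K = begin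
    + (ℓ ^ suc e) * g′ i j K        ≡⟨ cong (_* g′ i j K) (ℤₚ.pos-* ℓ (ℓ ^ e)) ⟩
    (+ ℓ * + (ℓ ^ e)) * g′ i j K    ≡⟨ xy∙z≈y∙xz (+ ℓ) (+ (ℓ ^ e)) (g′ i j K) ⟩
    + (ℓ ^ e) * (+ ℓ * g′ i j K)    ≈⟨ *-congˡ (+ (ℓ ^ e)) (proj₂ (proj₂ (quotients i j)) K) ⟩
    + (ℓ ^ e) * g i j K             ≈⟨ γ≡ℓᵉg i j K ⟩
    γ i j K                         ∎
    where open ≡-mod-Reasoning (ℓ ^ K)

powerFactor⇒∣ : (γ : Mat n) → ∀ e → PowerFactor ℓ n γ e → ∀ i j → + (ℓ ^ e) ∣ γ i j e
powerFactor⇒∣ γ e (g , _ , γ≡ℓᵉg , _) i j =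
  ∣-respʳ-≡-mod (≡-mod-sym (γ≡ℓᵉg i j e)) (∣m⇒∣m*n (g i j e) ∣-refl)

descent : Prime ℓ → (γ : Mat n) → CoherentMat ℓ n γ → CokerΔTorsionFree ℓ n γ →
  (∀ i j → + ℓ ∣ γ i j 1) → ∀ i j K → + (ℓ ^ K) ∣ γ i j K
descent {ℓ} {n} ℓ-prime γ γ-coh Δ-torsionFree ℓ∣γ i j K = powerFactor⇒∣ γ K (factor K) i j
  where
  factor : ∀ e → PowerFactor ℓ n γ e
  factor zero    = powerFactor-zero γ γ-coh ℓ∣γ
  factor (suc e) = powerFactor-suc ℓ-prime γ Δ-torsionFree e (factor e)

vanishing⇒torsionFree : (γ : Mat n) → (∀ i j K → + (ℓ ^ K) ∣ γ i j K) →
  CokerΔTorsionFree ℓ n γ → CokerTorsionFree ℓ n γ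
vanishing⇒torsionFree {n} {ℓ} γ γ≈0 Δ-torsionFree a a-coh a≉0 x x-coh (v , _ , γv≈ax) =
  (λ _ → 𝟘) , (λ _ → const-coherent (+ 0)) , γ0≈x
  where
  γw≡0 : ∀ w i K → act n γ w i K ≡ + 0 [mod ℓ ^ K ]
  γw≡0 w i K = ∣⇒≡-mod-0 (act-∣ n γ w i (λ p q → γ≈0 p q K))

  γΔs≡0 : ∀ s i j K → actΔ n γ s i j K ≡ + 0 [mod ℓ ^ K ]
  γΔs≡0 s i j K = ∣⇒≡-mod-0 (actΔ-∣ n γ s i j (λ p q → γ≈0 p q K))

  X : Tens n
  X i _ = x i

  γΔ0≈aX : ∀ i j → actΔ n γ (λ _ _ → 𝟘) i j ≈[ ℓ ] (a ⊛ X i j)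
  γΔ0≈aX i j K = toUnsigned (begin
    actΔ n γ (λ _ _ → 𝟘) i j K  ≈⟨ γΔs≡0 (λ _ _ → 𝟘) i j K ⟩
    + 0                         ≈⟨ γw≡0 v i K ⟨
    act n γ v i K               ≈⟨ fromUnsigned (γv≈ax i K) ⟩
    a K * x i K                 ∎)
    where open ≡-mod-Reasoning (ℓ ^ K)

  preimage : InImageΔ ℓ n γ X
  preimage = Δ-torsionFree a a-coh a≉0 X (λ i _ → x-coh i)
    ((λ _ _ → 𝟘) , (λ _ _ → const-coherent (+ 0)) , γΔ0≈aX)

  γ0≈x : ∀ i → act n γ (λ _ → 𝟘) i ≈[ ℓ ] x i
  γ0≈x i K = toUnsigned (begin
    act n γ (λ _ → 𝟘) i K        ≈⟨ γw≡0 (λ _ → 𝟘) i K ⟩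
    + 0                          ≈⟨ γΔs≡0 (proj₁ preimage) i i K ⟨
    actΔ n γ (proj₁ preimage) i i K  ≈⟨ fromUnsigned (proj₂ (proj₂ preimage) i i K) ⟩
    x i K                        ∎)
    where open ≡-mod-Reasoning (ℓ ^ K)

∃¬⊎∀ : {P : Fin n → Fin n → Set} → (∀ i j → Dec (P i j)) → (∃₂ λ i j → ¬ P i j) ⊎ (∀ i j → P i j)
∃¬⊎∀ {n} P? with all? (λ i → all? (P? i))
... | yes ∀P = inj₂ ∀P
... | no ¬∀P with ¬∀⟶∃¬ n _ (λ i → all? (P? i)) ¬∀P
... | i , ¬∀Pᵢ with ¬∀⟶∃¬ n _ (P? i) ¬∀Pᵢ
... | j , ¬Pᵢⱼ = inj₁ (i , j , ¬Pᵢⱼ)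

lemma5p11 : (ℓ : ℕ) → Prime ℓ → (n : ℕ) → (γ : Mat n) → CoherentMat ℓ n γ →
    CokerΔTorsionFree ℓ n γ → CokerTorsionFree ℓ n γ
lemma5p11 ℓ ℓ-prime n γ γ-coh Δ-torsionFree with ∃¬⊎∀ (λ i j → + ℓ ∣? γ i j 1)
... | inj₁ (r , l , ℓ∤γrl) = unit-entry⇒torsionFree ℓ-prime γ γ-coh Δ-torsionFree r l ℓ∤γrl
... | inj₂ ℓ∣γ = vanishing⇒torsionFree γ (descent ℓ-prime γ γ-coh Δ-torsionFree ℓ∣γ) Δ-torsionFree
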